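{- In the setting described in the context, if $o(b)=rd$, then $\langle K,a\rangle\cap\langle b\rangle=\langle b^d\rangle$. In particular, if $o(b)=d$, then $G(a,b)=(K\rtimes\langle a\rangle)\rtimes\langle b\rangle$.
   Context: Let $p\geq5$ be a prime and $G\leq\mathrm{Sym}(\Omega)$ transitive with $|\Omega|=3p$, whose only non-trivial $G$-invariant partition is $\mathcal{B}=\{B_1,\dots,B_p\}$ with $|B_i|=3$. Let $\overline{G}\leq\mathrm{Sym}(\mathcal{B})$ be the induced group and $K=\ker(G\to\overline{G})$ the kernel of the action on $\mathcal{B}$. Assume $K\neq1$, $K$ contains no derangement (every element of $K$ fixes a point of $\Omega$), and every minimal normal subgroup of $G$ contained in $K$ is an elementary abelian $3$-group. Assume $\overline{G}$ is solvable, so $\overline{G}=\langle\alpha\rangle\rtimes\langle\beta\rangle\leq\mathrm{AGL}(1,p)$ with $\alpha$ a $p$-cycle, $o(\beta)=d\mid p-1$, $\beta$ fixing $B_1$, and $\beta\alpha\beta^{ -1}=\alpha^t$ for some $t$ coprime to $p$. Let $a\in G$ be a semiregular element of order $p$ (a product of three $p$-cycles) whose image in $\overline{G}$ is $\alpha$, and $b\in G$ an element whose image is $\beta$, with $o(b)=rd$ for a positive integer $r$. Let $G(a,b)=\langle K,a,b\rangle$. $o(x)$ denotes the order of $x$. -}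

module Defs where

open import Level using (0ℓ)
open import Data.Nat using (ℕ; zero; suc; _<_)
open import Data.Fin using (Fin)
open import Data.Fin.Permutation using (Permutation′; _⟨$⟩ʳ_; _∘ₚ_; flip; _≈_)
  renaming (id to idₚ)
open import Data.Product using (Σ; ∃; _×_; _,_)
open import Data.Sum using (_⊎_)
open import Relation.Binary.PropositionalEquality using (_≡_; _≢_)
open import Relation.Nullary using (¬_)
open import Relation.Unary using (Pred; _∈_; _⊆_; _∩_)

Perm : ℕ → Set
Perm n = Permutation′ n

PermSet : ℕ → Set₁
PermSet n = Pred (Perm n) 0ℓ

module _ {n : ℕ} where

  -- Usual (right-to-left) composition: (σ · τ) x = σ (τ x).
  infixl 7 _·_
  _·_ : Perm n → Perm n → Perm n
  σ · τ = τ ∘ₚ σ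

  _⁻¹ : Perm n → Perm n
  σ ⁻¹ = flip σ

  infixr 8 _^_
  _^_ : Perm n → ℕ → Perm n
  σ ^ zero  = idₚ
  σ ^ suc k = σ · (σ ^ k)

  IsOrder : Perm n → ℕ → Set
  IsOrder σ k = (0 < k) × ((σ ^ k) ≈ idₚ)
              × (∀ j → 0 < j → j < k → ¬ ((σ ^ j) ≈ idₚ))

  record IsSubgroup (H : PermSet n) : Set where
    field
      id∈   : idₚ ∈ H
      ·∈    : ∀ {σ τ} → σ ∈ H → τ ∈ H → (σ · τ) ∈ H
      ⁻¹∈   : ∀ {σ} → σ ∈ H → (σ ⁻¹) ∈ H
      resp≈ : ∀ {σ τ} → σ ≈ τ → σ ∈ H → τ ∈ H

  data ⟨_⟩ (S : PermSet n) : PermSet n where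
    gen  : ∀ {σ} → σ ∈ S → σ ∈ ⟨ S ⟩
    one  : idₚ ∈ ⟨ S ⟩
    mul  : ∀ {σ τ} → σ ∈ ⟨ S ⟩ → τ ∈ ⟨ S ⟩ → (σ · τ) ∈ ⟨ S ⟩
    inv  : ∀ {σ} → σ ∈ ⟨ S ⟩ → (σ ⁻¹) ∈ ⟨ S ⟩
    resp : ∀ {σ τ} → σ ≈ τ → σ ∈ ⟨ S ⟩ → τ ∈ ⟨ S ⟩

  IsTrivial : PermSet n → Set
  IsTrivial H = ∀ {σ} → σ ∈ H → σ ≈ idₚ

  IsNormalIn : PermSet n → PermSet n → Set
  IsNormalIn N G = ∀ {g ν} → g ∈ G → ν ∈ N → (g · ν · (g ⁻¹)) ∈ N

  IsMinimalNormal : PermSet n → PermSet n → Set₁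
  IsMinimalNormal N G =
    IsSubgroup N × N ⊆ G × IsNormalIn N G × ¬ IsTrivial N
    × (∀ (M : PermSet n) → IsSubgroup M → M ⊆ N → IsNormalIn M G
         → ¬ IsTrivial M → N ⊆ M)

  IsElemAbelian3 : PermSet n → Set
  IsElemAbelian3 N =
    (∀ {σ τ} → σ ∈ N → τ ∈ N → (σ · τ) ≈ (τ · σ))
    × (∀ {σ} → σ ∈ N → (σ ^ 3) ≈ idₚ)

  IsInnerSemidirect : PermSet n → PermSet n → PermSet n → Set
  IsInnerSemidirect H N Q =
    IsSubgroup N × IsSubgroup Q × N ⊆ H × Q ⊆ H × IsNormalIn N H
    × IsTrivial (N ∩ Q)
    × (∀ {h} → h ∈ H → Σ (Perm n) λ ν → Σ (Perm n) λ q →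
         ν ∈ N × q ∈ Q × h ≈ (ν · q))

  IsTransitive : PermSet n → Set
  IsTransitive G = ∀ x y → ∃ λ g → g ∈ G × g ⟨$⟩ʳ x ≡ y

  IsSemiregular : Perm n → Set
  IsSemiregular σ = ∀ k x → (σ ^ k) ⟨$⟩ʳ x ≡ x → (σ ^ k) ≈ idₚ

  IsFullCycle : Perm n → Set
  IsFullCycle σ = ∀ x y → ∃ λ k → (σ ^ k) ⟨$⟩ʳ x ≡ y

  IsDerangement : Perm n → Set
  IsDerangement σ = ∀ x → σ ⟨$⟩ʳ x ≢ x

  IsInvariantPartition : PermSet n → (Fin n → Fin n → Set) → Set
  IsInvariantPartition G R =
    (∀ x → R x x) × (∀ {x y} → R x y → R y x)
    × (∀ {x y z} → R x y → R y z → R x z)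
    × (∀ {g x y} → g ∈ G → R x y → R (g ⟨$⟩ʳ x) (g ⟨$⟩ʳ y))

  IsNontrivialPartition : (Fin n → Fin n → Set) → Set
  IsNontrivialPartition R =
    (∃ λ x → ∃ λ y → x ≢ y × R x y) × (∃ λ x → ∃ λ y → ¬ R x y)

-- A block map blk : Fin n → Fin m, all of whose fibres have exactly 3
-- elements; the blocks are B_i = blk⁻¹(i).
FibresOfSize3 : ∀ {n m} → (Fin n → Fin m) → Set
FibresOfSize3 blk = ∀ i → ∃ λ x → ∃ λ y → ∃ λ z →
  x ≢ y × x ≢ z × y ≢ z × blk x ≡ i × blk y ≡ i × blk z ≡ i
  × (∀ w → blk w ≡ i → w ≡ x ⊎ w ≡ y ⊎ w ≡ z)

Induces : ∀ {n m} → (Fin n → Fin m) → Perm n → Perm m → Set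
Induces blk g π = ∀ x → blk (g ⟨$⟩ʳ x) ≡ π ⟨$⟩ʳ blk x

Induced : ∀ {n m} → (Fin n → Fin m) → PermSet n → PermSet m
Induced blk G π = ∃ λ g → g ∈ G × Induces blk g π

Kernel : ∀ {n m} → (Fin n → Fin m) → PermSet n → PermSet n
Kernel blk G g = g ∈ G × Induces blk g idₚ

-- Elements of N = ⟨K, a⟩ act on the blocks as elements of the regular cyclic group
-- ⟨α⟩, while b ^ i acts as β ^ i, which fixes the block B₁. An element of ⟨α⟩
-- fixing a block is trivial, so b ^ i ∈ N forces β ^ i = 1, i.e. d ∣ i; conversely
-- b ^ d lies in the kernel K. For the semidirect decompositions: K ∩ ⟨a⟩ = 1 because
-- elements of K fix a point whereas non-trivial powers of the semiregular a fix none,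
-- and b normalises N because b a b⁻¹ ∈ K a ^ t; when o(b) = d, N ∩ ⟨b⟩ = ⟨b ^ d⟩ = 1.
-- Primality of p, transitivity, uniqueness of the block system, K ≠ 1, the minimal
-- normal subgroups, d ∣ p − 1, gcd(t, p) = 1 and the description of the induced
-- group play no role.
module Submission where

open import Defs
open import Level using (0ℓ)
open import Algebra.Bundles using (Group)
open import Algebra.Definitions using (Congruent₁; Congruent₂)
open import Algebra.Structures using (IsGroup)
open import Data.Nat using (ℕ; zero; suc; _+_; _*_; _∸_; _≤_; _<_; s≤s; z≤n; _%_; _/_)
open import Data.Nat.Properties using (*-identityˡ)
open import Data.Nat.DivMod using (m≡m%n+[m/n]*n; m%n<n)
open import Data.Nat.Divisibility using (_∣_; divides; m%n≡0⇒n∣m)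
open import Data.Nat.Primality using (Prime)
open import Data.Nat.Coprimality using (Coprime)
open import Data.Fin using (Fin; _≟_)
open import Data.Fin.Properties using (¬∀⟶∃¬)
open import Data.Fin.Permutation using (_⟨$⟩ʳ_; _⟨$⟩ˡ_; _≈_; inverseˡ; inverseʳ)
  renaming (id to idₚ)
open import Data.Product using (Σ; ∃; ∃₂; _×_; _,_; proj₁; proj₂)
open import Data.Sum using (inj₁; inj₂)
open import Data.Empty using (⊥-elim)
open import Function.Definitions using (StrictlySurjective)
open import Relation.Binary.Structures using (IsEquivalence)
open import Relation.Binary.PropositionalEquality
  using (_≡_; _≢_; refl; sym; trans; cong; subst)
open import Relation.Nullary using (¬_)
open import Relation.Nullary.Decidable using (¬?; decidable-stable)
open import Relation.Unary using (_∈_; _⊆_; _∩_; _∪_; _≐_; ｛_｝)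

import Algebra.Properties.Group as GroupProperties
import Relation.Binary.Reasoning.Setoid as SetoidReasoning

module _ {n : ℕ} where

  -- A record around _≈_: unfolded to a Π-type, _≈_ would keep Agda from
  -- inferring the permutations it relates.
  infix 4 _≋_
  record _≋_ (σ τ : Perm n) : Set where
    constructor ≈⇒≋
    field ≋⇒≈ : σ ≈ τ
  open _≋_ public

  ≋-isEquivalence : IsEquivalence _≋_
  ≋-isEquivalence = record
    { refl  = ≈⇒≋ λ _ → refl
    ; sym   = λ (≈⇒≋ e) → ≈⇒≋ λ i → sym (e i)
    ; trans = λ (≈⇒≋ e) (≈⇒≋ f) → ≈⇒≋ λ i → trans (e i) (f i)
    }

  ·-cong : Congruent₂ _≋_ _·_
  ·-cong {σ} {σ′} {τ} {τ′} (≈⇒≋ e) (≈⇒≋ f) =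
    ≈⇒≋ λ i → trans (cong (σ ⟨$⟩ʳ_) (f i)) (e (τ′ ⟨$⟩ʳ i))

  ⁻¹-cong : Congruent₁ _≋_ _⁻¹
  ⁻¹-cong {σ} {τ} (≈⇒≋ e) =
    ≈⇒≋ λ i → trans (sym (inverseˡ τ)) (cong (τ ⟨$⟩ˡ_) (trans (sym (e _)) (inverseʳ σ)))

  ·-isGroup : IsGroup _≋_ _·_ idₚ _⁻¹
  ·-isGroup = record
    { isMonoid = record
      { isSemigroup = record
        { isMagma = record { isEquivalence = ≋-isEquivalence ; ∙-cong = ·-cong }
        ; assoc = λ _ _ _ → ≈⇒≋ λ _ → refl
        }
      ; identity = (λ _ → ≈⇒≋ λ _ → refl) , (λ _ → ≈⇒≋ λ _ → refl)
      }
    ; inverse = (λ σ → ≈⇒≋ λ _ → inverseˡ σ) , (λ σ → ≈⇒≋ λ _ → inverseʳ σ)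
    ; ⁻¹-cong = ⁻¹-cong
    }

Sym : ℕ → Group 0ℓ 0ℓ
Sym n = record { isGroup = ·-isGroup {n} }

module _ {n : ℕ} where

  open Group (Sym n) public
    using (assoc; identityˡ; identityʳ)
    renaming (refl to ≋-refl; sym to ≋-sym; trans to ≋-trans;
              inverseˡ to ·-inverseˡ; inverseʳ to ·-inverseʳ)
  open GroupProperties (Sym n) using (inverseʳ-unique; ⁻¹-anti-homo-∙; ⁻¹-involutive; ε⁻¹≈ε)
  open SetoidReasoning (Group.setoid (Sym n))

  private variable
    σ τ g h : Perm n
    S T H L N Q : PermSet n

  ·-congˡ : ∀ σ {τ τ′} → τ ≋ τ′ → σ · τ ≋ σ · τ′
  ·-congˡ σ = ·-cong (≋-refl {σ})

  ·-congʳ : ∀ {σ σ′} τ → σ ≋ σ′ → σ · τ ≋ σ′ · τ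
  ·-congʳ τ σ≋σ′ = ·-cong σ≋σ′ (≋-refl {τ})

  ^-homo-+ : ∀ σ j k → σ ^ (j + k) ≋ σ ^ j · σ ^ k
  ^-homo-+ σ zero    k = ≋-refl
  ^-homo-+ σ (suc j) k = ·-congˡ σ (^-homo-+ σ j k)

  ^-fixes : ∀ {x} → σ ⟨$⟩ʳ x ≡ x → ∀ k → (σ ^ k) ⟨$⟩ʳ x ≡ x
  ^-fixes σx≡x zero    = refl
  ^-fixes {σ} σx≡x (suc k) = trans (cong (σ ⟨$⟩ʳ_) (^-fixes σx≡x k)) σx≡x

  ^-*-≋id : ∀ {k} → σ ^ k ≋ idₚ → ∀ q → σ ^ (q * k) ≋ idₚ
  ^-*-≋id σᵏ≋id zero = ≋-refl
  ^-*-≋id {σ = σ} {k = k} σᵏ≋id (suc q) = begin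
    σ ^ (k + q * k)        ≈⟨ ^-homo-+ σ k (q * k) ⟩
    σ ^ k · σ ^ (q * k)    ≈⟨ ·-cong σᵏ≋id (^-*-≋id σᵏ≋id q) ⟩
    idₚ · idₚ              ≈⟨ identityˡ idₚ ⟩
    idₚ                    ∎

  order-∣ : ∀ {k i} → IsOrder σ k → σ ^ i ≋ idₚ → k ∣ i
  order-∣ {σ = σ} {k = k@(suc _)} {i = i} (_ , σᵏ≋id , minimal) σⁱ≋id = m%n≡0⇒n∣m i k i%k≡0
    where
    q = i / k
    σ^[i%k]≋id : σ ^ (i % k) ≋ idₚ
    σ^[i%k]≋id = begin
      σ ^ (i % k)                  ≈⟨ identityʳ (σ ^ (i % k)) ⟨
      σ ^ (i % k) · idₚ            ≈⟨ ·-congˡ (σ ^ (i % k)) (^-*-≋id (≈⇒≋ σᵏ≋id) q) ⟨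
      σ ^ (i % k) · σ ^ (q * k)    ≈⟨ ^-homo-+ σ (i % k) (q * k) ⟨
      σ ^ (i % k + q * k)          ≡⟨ cong (σ ^_) (m≡m%n+[m/n]*n i k) ⟨
      σ ^ i                        ≈⟨ σⁱ≋id ⟩
      idₚ                          ∎
    i%k≡0 : i % k ≡ 0
    i%k≡0 with i % k in i%k≡r | m%n<n i k
    ... | zero  | _   = refl
    ... | suc r | r<k = ⊥-elim (minimal (suc r) (s≤s z≤n) r<k
                          (≋⇒≈ (subst (λ j → σ ^ j ≋ idₚ) i%k≡r σ^[i%k]≋id)))

  ∈-resp-≋ : IsSubgroup H → σ ≋ τ → σ ∈ H → τ ∈ H
  ∈-resp-≋ H-isSubgroup (≈⇒≋ e) = IsSubgroup.resp≈ H-isSubgroup e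

  ^∈ : IsSubgroup H → σ ∈ H → ∀ k → σ ^ k ∈ H
  ^∈ H-isSubgroup σ∈H zero    = IsSubgroup.id∈ H-isSubgroup
  ^∈ H-isSubgroup σ∈H (suc k) = IsSubgroup.·∈ H-isSubgroup σ∈H (^∈ H-isSubgroup σ∈H k)

  ∩-isSubgroup : IsSubgroup H → IsSubgroup L → IsSubgroup (H ∩ L)
  ∩-isSubgroup H-isSubgroup L-isSubgroup = record
    { id∈   = H.id∈ , L.id∈
    ; ·∈    = λ (σ∈H , σ∈L) (τ∈H , τ∈L) → H.·∈ σ∈H τ∈H , L.·∈ σ∈L τ∈L
    ; ⁻¹∈   = λ (σ∈H , σ∈L) → H.⁻¹∈ σ∈H , L.⁻¹∈ σ∈L
    ; resp≈ = λ e (σ∈H , σ∈L) → H.resp≈ e σ∈H , L.resp≈ e σ∈L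
    }
    where
    module H = IsSubgroup H-isSubgroup
    module L = IsSubgroup L-isSubgroup

  ⟨⟩-isSubgroup : IsSubgroup ⟨ S ⟩
  ⟨⟩-isSubgroup = record { id∈ = one ; ·∈ = mul ; ⁻¹∈ = inv ; resp≈ = resp }

  ⟨⟩-least : IsSubgroup H → S ⊆ H → ⟨ S ⟩ ⊆ H
  ⟨⟩-least H-isSubgroup S⊆H (gen σ∈S)   = S⊆H σ∈S
  ⟨⟩-least H-isSubgroup S⊆H one         = IsSubgroup.id∈ H-isSubgroup
  ⟨⟩-least H-isSubgroup S⊆H (mul σ∈ τ∈) =
    IsSubgroup.·∈ H-isSubgroup (⟨⟩-least H-isSubgroup S⊆H σ∈) (⟨⟩-least H-isSubgroup S⊆H τ∈)
  ⟨⟩-least H-isSubgroup S⊆H (inv σ∈)    = IsSubgroup.⁻¹∈ H-isSubgroup (⟨⟩-least H-isSubgroup S⊆H σ∈)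
  ⟨⟩-least H-isSubgroup S⊆H (resp e σ∈) = IsSubgroup.resp≈ H-isSubgroup e (⟨⟩-least H-isSubgroup S⊆H σ∈)

  ⟨⟩-mono : S ⊆ T → ⟨ S ⟩ ⊆ ⟨ T ⟩
  ⟨⟩-mono S⊆T = ⟨⟩-least ⟨⟩-isSubgroup (λ σ∈S → gen (S⊆T σ∈S))

  ⟨⟩-trivial : (∀ {σ} → σ ∈ S → σ ≋ idₚ) → IsTrivial ⟨ S ⟩
  ⟨⟩-trivial S≋id σ∈⟨S⟩ = ≋⇒≈ (⟨⟩-least ≋id-isSubgroup S≋id σ∈⟨S⟩)
    where
    ≋id-isSubgroup : IsSubgroup (_≋ idₚ)
    ≋id-isSubgroup = record
      { id∈   = ≋-refl
      ; ·∈    = λ σ≋id τ≋id → ≋-trans (·-cong σ≋id τ≋id) (identityˡ idₚ)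
      ; ⁻¹∈   = λ σ≋id → ≋-trans (⁻¹-cong σ≋id) ε⁻¹≈ε
      ; resp≈ = λ e σ≋id → ≋-trans (≋-sym (≈⇒≋ e)) σ≋id
      }

  ⟨⟩-cyclic : ∀ {k} → IsOrder σ k → τ ∈ ⟨ ｛ σ ｝ ⟩ → ∃ λ i → τ ≋ σ ^ i
  ⟨⟩-cyclic {σ = σ} {k = suc m} (_ , σᵏ≋id , _) =
    ⟨⟩-least powers-isSubgroup (λ { refl → 1 , ≋-sym (identityʳ σ) })
    where
    Power : Perm n → Set
    Power τ = ∃ λ i → τ ≋ σ ^ i
    σ⁻¹≋σᵐ : σ ⁻¹ ≋ σ ^ m
    σ⁻¹≋σᵐ = ≋-sym (inverseʳ-unique σ (σ ^ m) (≈⇒≋ σᵏ≋id))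
    inverse-power : ∀ j → Power ((σ ^ j) ⁻¹)
    inverse-power zero    = 0 , ε⁻¹≈ε
    inverse-power (suc j) with inverse-power j
    ... | i , σʲ⁻¹≋σⁱ = i + m , (begin
      (σ · σ ^ j) ⁻¹           ≈⟨ ⁻¹-anti-homo-∙ σ (σ ^ j) ⟩
      (σ ^ j) ⁻¹ · σ ⁻¹        ≈⟨ ·-cong σʲ⁻¹≋σⁱ σ⁻¹≋σᵐ ⟩
      σ ^ i · σ ^ m            ≈⟨ ^-homo-+ σ i m ⟨
      σ ^ (i + m)              ∎)
    powers-isSubgroup : IsSubgroup Power
    powers-isSubgroup = record
      { id∈   = 0 , ≋-refl
      ; ·∈    = λ (i , τ≋σⁱ) (j , υ≋σʲ) → i + j , ≋-trans (·-cong τ≋σⁱ υ≋σʲ) (≋-sym (^-homo-+ σ i j))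
      ; ⁻¹∈   = λ (j , τ≋σʲ) → let (i , σʲ⁻¹≋σⁱ) = inverse-power j in i , ≋-trans (⁻¹-cong τ≋σʲ) σʲ⁻¹≋σⁱ
      ; resp≈ = λ e (i , τ≋σⁱ) → i , ≋-trans (≋-sym (≈⇒≋ e)) τ≋σⁱ
      }

  ^∈⟨^⟩ : ∀ σ {d i} → d ∣ i → σ ^ i ∈ ⟨ ｛ σ ^ d ｝ ⟩
  ^∈⟨^⟩ σ {d} (divides q refl) = ^[q*d]∈ q
    where
    ^[q*d]∈ : ∀ q → σ ^ (q * d) ∈ ⟨ ｛ σ ^ d ｝ ⟩
    ^[q*d]∈ zero    = one
    ^[q*d]∈ (suc q) = resp (≋⇒≈ (≋-sym (^-homo-+ σ d (q * d)))) (mul (gen refl) (^[q*d]∈ q))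

  Commute : Perm n → Perm n → Set
  Commute σ τ = σ · τ ≋ τ · σ

  centraliser-isSubgroup : ∀ α → IsSubgroup (λ γ → Commute γ α)
  centraliser-isSubgroup α = record
    { id∈   = ≋-refl
    ; ·∈    = λ {γ} {δ} γα≋αγ δα≋αδ → begin
        γ · δ · α       ≈⟨ assoc γ δ α ⟩
        γ · (δ · α)     ≈⟨ ·-congˡ γ δα≋αδ ⟩
        γ · (α · δ)     ≈⟨ assoc γ α δ ⟨
        γ · α · δ       ≈⟨ ·-congʳ δ γα≋αγ ⟩
        α · γ · δ       ≈⟨ assoc α γ δ ⟩
        α · (γ · δ)     ∎
    ; ⁻¹∈   = λ {γ} γα≋αγ → begin
        γ ⁻¹ · α                  ≈⟨ identityʳ (γ ⁻¹ · α) ⟨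
        γ ⁻¹ · α · idₚ            ≈⟨ ·-congˡ (γ ⁻¹ · α) (·-inverseʳ γ) ⟨
        γ ⁻¹ · α · (γ · γ ⁻¹)     ≈⟨ assoc (γ ⁻¹ · α) γ (γ ⁻¹) ⟨
        γ ⁻¹ · α · γ · γ ⁻¹       ≈⟨ ·-congʳ (γ ⁻¹) (assoc (γ ⁻¹) α γ) ⟩
        γ ⁻¹ · (α · γ) · γ ⁻¹     ≈⟨ ·-congʳ (γ ⁻¹) (·-congˡ (γ ⁻¹) γα≋αγ) ⟨
        γ ⁻¹ · (γ · α) · γ ⁻¹     ≈⟨ ·-congʳ (γ ⁻¹) (assoc (γ ⁻¹) γ α) ⟨
        γ ⁻¹ · γ · α · γ ⁻¹       ≈⟨ ·-congʳ (γ ⁻¹) (·-congʳ α (·-inverseˡ γ)) ⟩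
        idₚ · α · γ ⁻¹            ≈⟨ ·-congʳ (γ ⁻¹) (identityˡ α) ⟩
        α · γ ⁻¹                  ∎
    ; resp≈ = λ {γ} {δ} γ≈δ γα≋αγ → let γ≋δ = ≈⇒≋ {σ = γ} {τ = δ} γ≈δ in begin
        δ · α   ≈⟨ ·-congʳ α γ≋δ ⟨
        γ · α   ≈⟨ γα≋αγ ⟩
        α · γ   ≈⟨ ·-congˡ α γ≋δ ⟩
        α · δ   ∎
    }

  ⟨⟩-commute : ∀ {α} → τ ∈ ⟨ ｛ α ｝ ⟩ → Commute τ α
  ⟨⟩-commute {α = α} = ⟨⟩-least (centraliser-isSubgroup α) (λ { refl → ≋-refl })

  commute-^ : ∀ {α} → Commute τ α → ∀ k → Commute τ (α ^ k)
  commute-^ {τ} {α} τα≋ατ zero    = ≋-refl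
  commute-^ {τ} {α} τα≋ατ (suc k) = begin
    τ · (α · α ^ k)     ≈⟨ assoc τ α (α ^ k) ⟨
    τ · α · α ^ k       ≈⟨ ·-congʳ (α ^ k) τα≋ατ ⟩
    α · τ · α ^ k       ≈⟨ assoc α τ (α ^ k) ⟩
    α · (τ · α ^ k)     ≈⟨ ·-congˡ α (commute-^ {τ} {α} τα≋ατ k) ⟩
    α · (α ^ k · τ)     ≈⟨ assoc α (α ^ k) τ ⟨
    α · α ^ k · τ       ∎

  -- γ commutes with every α ^ k, and these carry x to every point.
  fullCycle-centraliser-fix⇒id : ∀ {α γ x} → IsFullCycle α → Commute γ α → γ ⟨$⟩ʳ x ≡ x → γ ≋ idₚ
  fullCycle-centraliser-fix⇒id {α = α} {γ} {x} α-full γα≋αγ γx≡x = ≈⇒≋ λ y → fixes y (α-full x y)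
    where
    fixes : ∀ y → (∃ λ k → (α ^ k) ⟨$⟩ʳ x ≡ y) → γ ⟨$⟩ʳ y ≡ y
    fixes _ (k , refl) = trans (≋⇒≈ (commute-^ {γ} {α} γα≋αγ k) x) (cong ((α ^ k) ⟨$⟩ʳ_) γx≡x)

  ¬derangement⇒fixedPoint : ¬ IsDerangement σ → ∃ λ x → σ ⟨$⟩ʳ x ≡ x
  ¬derangement⇒fixedPoint {σ} σ-moves-no-point
    with ¬∀⟶∃¬ n (λ x → σ ⟨$⟩ʳ x ≢ x) (λ x → ¬? (σ ⟨$⟩ʳ x ≟ x)) σ-moves-no-point
  ... | x , ¬σx≢x = x , decidable-stable (σ ⟨$⟩ʳ x ≟ x) ¬σx≢x

  semiregular-fix⇒id : ∀ {a k x} → IsOrder a k → IsSemiregular a → τ ∈ ⟨ ｛ a ｝ ⟩ → τ ⟨$⟩ʳ x ≡ x → τ ≋ idₚ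
  semiregular-fix⇒id {τ} {x = x} a-order a-semiregular τ∈⟨a⟩ τx≡x with ⟨⟩-cyclic a-order τ∈⟨a⟩
  ... | i , τ≋aⁱ = ≋-trans τ≋aⁱ (≈⇒≋ (a-semiregular i x (trans (sym (≋⇒≈ τ≋aⁱ x)) τx≡x)))

  Normalises : Perm n → PermSet n → Set
  Normalises g N = ∀ {ν} → ν ∈ N → g · ν · g ⁻¹ ∈ N

  ∈⇒normalises : IsSubgroup N → g ∈ N → Normalises g N
  ∈⇒normalises N-isSubgroup g∈N ν∈N = ·∈ (·∈ g∈N ν∈N) (⁻¹∈ g∈N)
    where open IsSubgroup N-isSubgroup

  normalises-· : IsSubgroup N → Normalises g N → Normalises h N → Normalises (g · h) N
  normalises-· N-isSubgroup g-normalises h-normalises ν∈N =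
    IsSubgroup.resp≈ N-isSubgroup (λ _ → refl) (g-normalises (h-normalises ν∈N))

  normalises-^ : IsSubgroup N → Normalises g N → ∀ k → Normalises (g ^ k) N
  normalises-^ N-isSubgroup g-normalises zero    = IsSubgroup.resp≈ N-isSubgroup (λ _ → refl)
  normalises-^ {g = g} N-isSubgroup g-normalises (suc k) =
    normalises-· {g = g} {h = g ^ k} N-isSubgroup g-normalises (normalises-^ N-isSubgroup g-normalises k)

  normalises-resp : IsSubgroup N → g ≋ h → Normalises g N → Normalises h N
  normalises-resp N-isSubgroup g≋h g-normalises {ν} ν∈N =
    ∈-resp-≋ N-isSubgroup (·-cong (·-congʳ ν g≋h) (⁻¹-cong g≋h)) (g-normalises ν∈N)

  conjugatePreimage-isSubgroup : IsSubgroup H → ∀ g → IsSubgroup (λ ν → g · ν · g ⁻¹ ∈ H)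
  conjugatePreimage-isSubgroup H-isSubgroup g = record
    { id∈   = ∈-resp-≋ H-isSubgroup id≋g·id·g⁻¹ id∈
    ; ·∈    = λ {σ} {τ} conj-σ∈H conj-τ∈H →
        resp≈ {σ = (g · σ · g ⁻¹) · (g · τ · g ⁻¹)} {τ = g · (σ · τ) · g ⁻¹}
          (λ _ → cong (λ x → g ⟨$⟩ʳ (σ ⟨$⟩ʳ x)) (inverseˡ g)) (·∈ conj-σ∈H conj-τ∈H)
    ; ⁻¹∈   = λ {σ} conj-σ∈H →
        ∈-resp-≋ H-isSubgroup (·-congʳ (g ⁻¹) (·-congʳ (σ ⁻¹) (⁻¹-involutive g))) (⁻¹∈ conj-σ∈H)
    ; resp≈ = λ {σ} {τ} σ≈τ → ∈-resp-≋ H-isSubgroup (·-congʳ (g ⁻¹) (·-congˡ g (≈⇒≋ {σ = σ} {τ = τ} σ≈τ)))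
    }
    where
    open IsSubgroup H-isSubgroup
    id≋g·id·g⁻¹ : idₚ ≋ g · idₚ · g ⁻¹
    id≋g·id·g⁻¹ = ≋-sym (≋-trans (·-congʳ (g ⁻¹) (identityʳ g)) (·-inverseʳ g))

  ⟨⟩-normalisedBy : (∀ {s} → s ∈ S → g · s · g ⁻¹ ∈ ⟨ S ⟩) → Normalises g ⟨ S ⟩
  ⟨⟩-normalisedBy {g = g} = ⟨⟩-least (conjugatePreimage-isSubgroup ⟨⟩-isSubgroup g)

  Products : PermSet n → PermSet n → PermSet n
  Products N Q h = ∃₂ λ ν q → ν ∈ N × q ∈ Q × h ≋ ν · q

  -- ν₁ q₁ ν₂ q₂ = ν₁ (q₁ ν₂ q₁⁻¹) q₁ q₂  and  (ν q)⁻¹ = (q⁻¹ ν⁻¹ q) q⁻¹.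
  Products-isSubgroup : IsSubgroup N → IsSubgroup Q → (∀ {q} → q ∈ Q → Normalises q N) →
                        IsSubgroup (Products N Q)
  Products-isSubgroup N-isSubgroup Q-isSubgroup Q-normalises = record
    { id∈   = idₚ , idₚ , N.id∈ , Q.id∈ , ≋-refl
    ; ·∈    = λ (ν₁ , q₁ , ν₁∈N , q₁∈Q , σ≋ν₁q₁) (ν₂ , q₂ , ν₂∈N , q₂∈Q , τ≋ν₂q₂) →
        ν₁ · (q₁ · ν₂ · q₁ ⁻¹) , q₁ · q₂ , N.·∈ ν₁∈N (Q-normalises q₁∈Q ν₂∈N) , Q.·∈ q₁∈Q q₂∈Q ,
        ≋-trans (·-cong σ≋ν₁q₁ τ≋ν₂q₂)
          (≈⇒≋ λ _ → cong (λ x → ν₁ ⟨$⟩ʳ (q₁ ⟨$⟩ʳ (ν₂ ⟨$⟩ʳ x))) (sym (inverseˡ q₁)))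
    ; ⁻¹∈   = λ (ν , q , ν∈N , q∈Q , σ≋νq) →
        q ⁻¹ · ν ⁻¹ · q ⁻¹ ⁻¹ , q ⁻¹ , Q-normalises (Q.⁻¹∈ q∈Q) (N.⁻¹∈ ν∈N) , Q.⁻¹∈ q∈Q ,
        ≋-trans (⁻¹-cong σ≋νq)
          (≈⇒≋ λ _ → cong (λ x → q ⟨$⟩ˡ (ν ⟨$⟩ˡ x)) (sym (inverseˡ (q ⁻¹))))
    ; resp≈ = λ {σ} {τ} σ≈τ (ν , q , ν∈N , q∈Q , σ≋νq) →
        ν , q , ν∈N , q∈Q , ≋-trans (≋-sym (≈⇒≋ {σ = σ} {τ = τ} σ≈τ)) σ≋νq
    }
    where
    module N = IsSubgroup N-isSubgroup
    module Q = IsSubgroup Q-isSubgroup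

  ⟨⟩-isInnerSemidirect : IsSubgroup N → IsSubgroup Q → (∀ {q} → q ∈ Q → Normalises q N) →
                         IsTrivial (N ∩ Q) → N ⊆ ⟨ S ⟩ → Q ⊆ ⟨ S ⟩ → S ⊆ Products N Q →
                         IsInnerSemidirect ⟨ S ⟩ N Q
  ⟨⟩-isInnerSemidirect {N = N} {Q = Q} {S = S}
    N-isSubgroup Q-isSubgroup Q-normalises N∩Q-trivial N⊆⟨S⟩ Q⊆⟨S⟩ S⊆NQ =
    N-isSubgroup , Q-isSubgroup , N⊆⟨S⟩ , Q⊆⟨S⟩ , ⟨S⟩-normalises , N∩Q-trivial , factorise
    where
    ⟨S⟩⊆NQ : ⟨ S ⟩ ⊆ Products N Q
    ⟨S⟩⊆NQ = ⟨⟩-least (Products-isSubgroup N-isSubgroup Q-isSubgroup Q-normalises) S⊆NQ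
    ⟨S⟩-normalises : IsNormalIn N ⟨ S ⟩
    ⟨S⟩-normalises h∈⟨S⟩ with ⟨S⟩⊆NQ h∈⟨S⟩
    ... | ν , q , ν∈N , q∈Q , h≋νq = normalises-resp N-isSubgroup (≋-sym h≋νq)
          (normalises-· {g = ν} {h = q} N-isSubgroup (∈⇒normalises N-isSubgroup ν∈N) (Q-normalises q∈Q))
    factorise : ∀ {h} → h ∈ ⟨ S ⟩ → Σ (Perm n) λ ν → Σ (Perm n) λ q → ν ∈ N × q ∈ Q × h ≈ (ν · q)
    factorise h∈⟨S⟩ with ⟨S⟩⊆NQ h∈⟨S⟩
    ... | ν , q , ν∈N , q∈Q , h≋νq = ν , q , ν∈N , q∈Q , ≋⇒≈ h≋νq

module BlockAction {n m : ℕ} (blk : Fin n → Fin m) where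

  Induces-· : ∀ {g h π ρ} → Induces blk g π → Induces blk h ρ → Induces blk (g · h) (π · ρ)
  Induces-· {h = h} {π = π} g↦π h↦ρ x = trans (g↦π (h ⟨$⟩ʳ x)) (cong (π ⟨$⟩ʳ_) (h↦ρ x))

  Induces-⁻¹ : ∀ {g π} → Induces blk g π → Induces blk (g ⁻¹) (π ⁻¹)
  Induces-⁻¹ {g = g} {π = π} g↦π x =
    trans (sym (inverseˡ π)) (cong (π ⟨$⟩ˡ_) (trans (sym (g↦π (g ⟨$⟩ˡ x))) (cong blk (inverseʳ g))))

  Induces-^ : ∀ {g π} → Induces blk g π → ∀ k → Induces blk (g ^ k) (π ^ k)
  Induces-^ g↦π zero    x = refl
  Induces-^ {g = g} {π = π} g↦π (suc k) = Induces-· {g} {g ^ k} {π} {π ^ k} g↦π (Induces-^ {g} {π} g↦π k)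

  Induces-respˡ : ∀ {g h π} → g ≋ h → Induces blk g π → Induces blk h π
  Induces-respˡ (≈⇒≋ g≈h) g↦π x = trans (cong blk (sym (g≈h x))) (g↦π x)

  Induces-respʳ : ∀ {g π ρ} → π ≋ ρ → Induces blk g π → Induces blk g ρ
  Induces-respʳ (≈⇒≋ π≈ρ) g↦π x = trans (g↦π x) (π≈ρ _)

  Induces-unique : StrictlySurjective _≡_ blk → ∀ {g π ρ} → Induces blk g π → Induces blk g ρ → π ≋ ρ
  Induces-unique blk-surjective {π = π} {ρ} g↦π g↦ρ = ≈⇒≋ λ i → agree i (blk-surjective i)
    where
    agree : ∀ i → (∃ λ x → blk x ≡ i) → π ⟨$⟩ʳ i ≡ ρ ⟨$⟩ʳ i
    agree i (x , refl) = trans (sym (g↦π x)) (g↦ρ x)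

  InducedIn : PermSet m → PermSet n
  InducedIn H g = ∃ λ π → π ∈ H × Induces blk g π

  InducedIn-isSubgroup : ∀ {H} → IsSubgroup H → IsSubgroup (InducedIn H)
  InducedIn-isSubgroup H-isSubgroup = record
    { id∈   = idₚ , id∈ , λ _ → refl
    ; ·∈    = λ {g} {h} (π , π∈H , g↦π) (ρ , ρ∈H , h↦ρ) →
        π · ρ , ·∈ π∈H ρ∈H , Induces-· {g} {h} {π} {ρ} g↦π h↦ρ
    ; ⁻¹∈   = λ {g} (π , π∈H , g↦π) → π ⁻¹ , ⁻¹∈ π∈H , Induces-⁻¹ {g = g} {π = π} g↦π
    ; resp≈ = λ {g} {h} g≈h (π , π∈H , g↦π) → π , π∈H , Induces-respˡ {π = π} (≈⇒≋ {σ = g} {τ = h} g≈h) g↦π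
    }
    where open IsSubgroup H-isSubgroup

  Kernel-isSubgroup : ∀ {G} → IsSubgroup G → IsSubgroup (Kernel blk G)
  Kernel-isSubgroup G-isSubgroup = record
    { id∈   = id∈ , λ _ → refl
    ; ·∈    = λ {g} {h} (g∈G , g↦id) (h∈G , h↦id) → ·∈ g∈G h∈G , Induces-· {g} {h} {idₚ} {idₚ} g↦id h↦id
    ; ⁻¹∈   = λ {g} (g∈G , g↦id) → ⁻¹∈ g∈G , Induces-⁻¹ {g = g} {π = idₚ} g↦id
    ; resp≈ = λ {g} {h} g≈h (g∈G , g↦id) →
        resp≈ g≈h g∈G , Induces-respˡ {π = idₚ} (≈⇒≋ {σ = g} {τ = h} g≈h) g↦id
    }
    where open IsSubgroup G-isSubgroup

  PreservesBlocks : PermSet n → Set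
  PreservesBlocks G = ∀ {g x y} → g ∈ G → blk x ≡ blk y → blk (g ⟨$⟩ʳ x) ≡ blk (g ⟨$⟩ʳ y)

  Kernel-normalisedBy : ∀ {G g} → IsSubgroup G → PreservesBlocks G → g ∈ G → Normalises g (Kernel blk G)
  Kernel-normalisedBy {g = g} G-isSubgroup G-preserves-blocks g∈G (ν∈G , ν↦id) =
    ·∈ (·∈ g∈G ν∈G) (⁻¹∈ g∈G) ,
    λ x → trans (G-preserves-blocks g∈G (ν↦id (g ⟨$⟩ˡ x))) (cong blk (inverseʳ g))
    where open IsSubgroup G-isSubgroup

module BlockKernel {n m : ℕ} {G : PermSet n} (G-isSubgroup : IsSubgroup G) (blk : Fin n → Fin m)
  (G-preserves-blocks : BlockAction.PreservesBlocks blk G)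
  where

  open BlockAction blk
  open GroupProperties (Sym m) using (x≈y⇒x∙y⁻¹≈ε)

  K : PermSet n
  K = Kernel blk G

  K-isSubgroup : IsSubgroup K
  K-isSubgroup = Kernel-isSubgroup G-isSubgroup

  G-normalises-K : ∀ {g} → g ∈ G → Normalises g K
  G-normalises-K = Kernel-normalisedBy G-isSubgroup G-preserves-blocks

  K⋊⟨a⟩ : ∀ {a k} → a ∈ G → IsOrder a k → IsSemiregular a → (∀ {ν} → ν ∈ K → ¬ IsDerangement ν) →
          IsInnerSemidirect ⟨ K ∪ ｛ a ｝ ⟩ K ⟨ ｛ a ｝ ⟩
  K⋊⟨a⟩ {a} a∈G a-order a-semiregular K-not-derangements =
    ⟨⟩-isInnerSemidirect K-isSubgroup ⟨⟩-isSubgroup ⟨a⟩-normalises-K K∩⟨a⟩-trivial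
      (λ ν∈K → gen (inj₁ ν∈K)) (⟨⟩-mono inj₂) generators-factorise
    where
    ⟨a⟩-normalises-K : ∀ {q} → q ∈ ⟨ ｛ a ｝ ⟩ → Normalises q K
    ⟨a⟩-normalises-K {q} q∈⟨a⟩ = G-normalises-K {q} (⟨⟩-least G-isSubgroup (λ { refl → a∈G }) q∈⟨a⟩)
    K∩⟨a⟩-trivial : IsTrivial (K ∩ ⟨ ｛ a ｝ ⟩)
    K∩⟨a⟩-trivial {ν} (ν∈K , ν∈⟨a⟩) with ¬derangement⇒fixedPoint {σ = ν} (K-not-derangements ν∈K)
    ... | x , νx≡x = ≋⇒≈ (semiregular-fix⇒id a-order a-semiregular ν∈⟨a⟩ νx≡x)
    generators-factorise : (K ∪ ｛ a ｝) ⊆ Products K ⟨ ｛ a ｝ ⟩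
    generators-factorise {ν} (inj₁ ν∈K) = ν , idₚ , ν∈K , one , ≋-sym (identityʳ ν)
    generators-factorise (inj₂ refl) = idₚ , a , IsSubgroup.id∈ K-isSubgroup , gen refl , ≋-sym (identityˡ a)

  module Lifts (blk-surjective : StrictlySurjective _≡_ blk)
    {α β : Perm m} {d : ℕ} {B₁ : Fin m}
    (α-fullCycle : IsFullCycle α) (β-order : IsOrder β d) (β-fixes-B₁ : β ⟨$⟩ʳ B₁ ≡ B₁)
    {a b : Perm n} (a∈G : a ∈ G) (a↦α : Induces blk a α) (b∈G : b ∈ G) (b↦β : Induces blk b β)
    where

    N : PermSet n
    N = ⟨ K ∪ ｛ a ｝ ⟩

    N-inducedIn-⟨α⟩ : N ⊆ InducedIn ⟨ ｛ α ｝ ⟩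
    N-inducedIn-⟨α⟩ = ⟨⟩-least (InducedIn-isSubgroup ⟨⟩-isSubgroup)
      λ { (inj₁ (_ , ν↦id)) → idₚ , one , ν↦id ; (inj₂ refl) → α , gen refl , a↦α }

    N-fix-B₁⇒trivialOnBlocks : ∀ {h π} → h ∈ N → Induces blk h π → π ⟨$⟩ʳ B₁ ≡ B₁ → π ≋ idₚ
    N-fix-B₁⇒trivialOnBlocks {h} {π} h∈N h↦π πB₁≡B₁ with N-inducedIn-⟨α⟩ h∈N
    ... | γ , γ∈⟨α⟩ , h↦γ = ≋-trans π≋γ (fullCycle-centraliser-fix⇒id α-fullCycle (⟨⟩-commute γ∈⟨α⟩) γB₁≡B₁)
      where
      π≋γ : π ≋ γ
      π≋γ = Induces-unique blk-surjective {h} h↦π h↦γ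
      γB₁≡B₁ : γ ⟨$⟩ʳ B₁ ≡ B₁
      γB₁≡B₁ = trans (sym (≋⇒≈ π≋γ B₁)) πB₁≡B₁

    bᵈ∈K : b ^ d ∈ K
    bᵈ∈K = ^∈ G-isSubgroup b∈G d ,
           Induces-respʳ {b ^ d} (≈⇒≋ {σ = β ^ d} {τ = idₚ} (proj₁ (proj₂ β-order))) (Induces-^ {b} {β} b↦β d)

    N∩⟨b⟩≐⟨bᵈ⟩ : ∀ {k} → IsOrder b k → (N ∩ ⟨ ｛ b ｝ ⟩) ≐ ⟨ ｛ b ^ d ｝ ⟩
    N∩⟨b⟩≐⟨bᵈ⟩ b-order = N∩⟨b⟩⊆⟨bᵈ⟩ , ⟨bᵈ⟩⊆N∩⟨b⟩
      where
      N∩⟨b⟩⊆⟨bᵈ⟩ : (N ∩ ⟨ ｛ b ｝ ⟩) ⊆ ⟨ ｛ b ^ d ｝ ⟩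
      N∩⟨b⟩⊆⟨bᵈ⟩ (h∈N , h∈⟨b⟩) with ⟨⟩-cyclic b-order h∈⟨b⟩
      ... | i , h≋bⁱ = resp (≋⇒≈ (≋-sym h≋bⁱ)) (^∈⟨^⟩ b (order-∣ {σ = β} {i = i} β-order βⁱ≋id))
        where
        βⁱ≋id : β ^ i ≋ idₚ
        βⁱ≋id = N-fix-B₁⇒trivialOnBlocks (∈-resp-≋ ⟨⟩-isSubgroup h≋bⁱ h∈N)
                  (Induces-^ {b} {β} b↦β i) (^-fixes β-fixes-B₁ i)
      ⟨bᵈ⟩⊆N∩⟨b⟩ : ⟨ ｛ b ^ d ｝ ⟩ ⊆ (N ∩ ⟨ ｛ b ｝ ⟩)
      ⟨bᵈ⟩⊆N∩⟨b⟩ = ⟨⟩-least (∩-isSubgroup ⟨⟩-isSubgroup ⟨⟩-isSubgroup)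
        λ { refl → gen (inj₁ bᵈ∈K) , ^∈ ⟨⟩-isSubgroup (gen refl) d }

    -- b a b⁻¹ and a ^ t induce the same permutation of the blocks, so they differ by an element of K.
    bab⁻¹∈N : ∀ {t} → β · α · β ⁻¹ ≋ α ^ t → b · a · b ⁻¹ ∈ N
    bab⁻¹∈N {t} βαβ⁻¹≋αᵗ =
      ∈-resp-≋ ⟨⟩-isSubgroup cancel (mul (gen (inj₁ c∈K)) (^∈ ⟨⟩-isSubgroup (gen (inj₂ refl)) t))
      where
      module G = IsSubgroup G-isSubgroup
      c : Perm n
      c = b · a · b ⁻¹ · (a ^ t) ⁻¹
      bab⁻¹↦βαβ⁻¹ : Induces blk (b · a · b ⁻¹) (β · α · β ⁻¹)
      bab⁻¹↦βαβ⁻¹ = Induces-· {b · a} {b ⁻¹} {β · α} {β ⁻¹}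
                      (Induces-· {b} {a} {β} {α} b↦β a↦α) (Induces-⁻¹ {b} {β} b↦β)
      aᵗ⁻¹↦αᵗ⁻¹ : Induces blk ((a ^ t) ⁻¹) ((α ^ t) ⁻¹)
      aᵗ⁻¹↦αᵗ⁻¹ = Induces-⁻¹ {a ^ t} {α ^ t} (Induces-^ {a} {α} a↦α t)
      c∈K : c ∈ K
      c∈K = G.·∈ (G.·∈ (G.·∈ b∈G a∈G) (G.⁻¹∈ b∈G)) (G.⁻¹∈ (^∈ G-isSubgroup a∈G t)) ,
            Induces-respʳ {c} (x≈y⇒x∙y⁻¹≈ε βαβ⁻¹≋αᵗ)
              (Induces-· {b · a · b ⁻¹} {(a ^ t) ⁻¹} {β · α · β ⁻¹} {(α ^ t) ⁻¹} bab⁻¹↦βαβ⁻¹ aᵗ⁻¹↦αᵗ⁻¹)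
      cancel : c · a ^ t ≋ b · a · b ⁻¹
      cancel = ≈⇒≋ λ _ → cong ((b · a · b ⁻¹) ⟨$⟩ʳ_) (inverseˡ (a ^ t))

    N⋊⟨b⟩ : ∀ {t} → IsOrder b d → β · α · β ⁻¹ ≋ α ^ t →
            IsInnerSemidirect ⟨ K ∪ ｛ a ｝ ∪ ｛ b ｝ ⟩ N ⟨ ｛ b ｝ ⟩
    N⋊⟨b⟩ {t} b-order βαβ⁻¹≋αᵗ =
      ⟨⟩-isInnerSemidirect ⟨⟩-isSubgroup ⟨⟩-isSubgroup ⟨b⟩-normalises-N N∩⟨b⟩-trivial
        (⟨⟩-mono λ { (inj₁ ν∈K) → inj₁ ν∈K ; (inj₂ refl) → inj₂ (inj₁ refl) })
        (⟨⟩-mono λ { refl → inj₂ (inj₂ refl) })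
        generators-factorise
      where
      b-normalises-N : Normalises b N
      b-normalises-N = ⟨⟩-normalisedBy {g = b}
        λ { (inj₁ ν∈K) → gen (inj₁ (G-normalises-K b∈G ν∈K)) ; (inj₂ refl) → bab⁻¹∈N {t} βαβ⁻¹≋αᵗ }
      ⟨b⟩-normalises-N : ∀ {q} → q ∈ ⟨ ｛ b ｝ ⟩ → Normalises q N
      ⟨b⟩-normalises-N q∈⟨b⟩ with ⟨⟩-cyclic b-order q∈⟨b⟩
      ... | i , q≋bⁱ =
        normalises-resp ⟨⟩-isSubgroup (≋-sym q≋bⁱ) (normalises-^ ⟨⟩-isSubgroup b-normalises-N i)
      N∩⟨b⟩-trivial : IsTrivial (N ∩ ⟨ ｛ b ｝ ⟩)
      N∩⟨b⟩-trivial h∈ = ⟨⟩-trivial (λ { refl → ≈⇒≋ (proj₁ (proj₂ b-order)) }) (proj₁ (N∩⟨b⟩≐⟨bᵈ⟩ b-order) h∈)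
      generators-factorise : (K ∪ ｛ a ｝ ∪ ｛ b ｝) ⊆ Products N ⟨ ｛ b ｝ ⟩
      generators-factorise {ν} (inj₁ ν∈K)  = ν , idₚ , gen (inj₁ ν∈K) , one , ≋-sym (identityʳ ν)
      generators-factorise (inj₂ (inj₁ refl)) = a , idₚ , gen (inj₂ refl) , one , ≋-sym (identityʳ a)
      generators-factorise (inj₂ (inj₂ refl)) = idₚ , b , one , gen refl , ≋-sym (identityˡ b)

proposition6p1 :
    (p : ℕ) → Prime p → 5 ≤ p →
    (G : PermSet (3 * p)) → IsSubgroup G → IsTransitive G →
    (blk : Fin (3 * p) → Fin p) → FibresOfSize3 blk →
    IsInvariantPartition G (λ x y → blk x ≡ blk y) →
    (∀ (R : Fin (3 * p) → Fin (3 * p) → Set) → IsInvariantPartition G R →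
       IsNontrivialPartition R →
       ∀ x y → (R x y → blk x ≡ blk y) × (blk x ≡ blk y → R x y)) →
    ¬ IsTrivial (Kernel blk G) →
    (∀ {g} → g ∈ Kernel blk G → ¬ IsDerangement g) →
    (∀ (N : PermSet (3 * p)) → IsMinimalNormal N G → N ⊆ Kernel blk G →
       IsElemAbelian3 N) →
    (α β : Perm p) (d t : ℕ) (B₁ : Fin p) →
    IsFullCycle α → IsOrder β d → d ∣ p ∸ 1 → β ⟨$⟩ʳ B₁ ≡ B₁ →
    Coprime t p → (β · α · (β ⁻¹)) ≈ (α ^ t) →
    Induced blk G ≐ ⟨ ｛ α ｝ ∪ ｛ β ｝ ⟩ →
    (a b : Perm (3 * p)) (r : ℕ) →
    a ∈ G → IsOrder a p → IsSemiregular a → Induces blk a α →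
    b ∈ G → Induces blk b β → 0 < r → IsOrder b (r * d) →
    ((⟨ Kernel blk G ∪ ｛ a ｝ ⟩ ∩ ⟨ ｛ b ｝ ⟩) ≐ ⟨ ｛ b ^ d ｝ ⟩)
    × (r ≡ 1 →
         IsInnerSemidirect ⟨ Kernel blk G ∪ ｛ a ｝ ⟩ (Kernel blk G) ⟨ ｛ a ｝ ⟩
         × IsInnerSemidirect ⟨ Kernel blk G ∪ ｛ a ｝ ∪ ｛ b ｝ ⟩
             ⟨ Kernel blk G ∪ ｛ a ｝ ⟩ ⟨ ｛ b ｝ ⟩)
proposition6p1 _ _ _ _ G-isSubgroup _ blk blocks-of-size-3 (_ , _ , _ , G-preserves-blocks) _ _
  K-not-derangements _ α _ d t _ α-fullCycle β-order _ β-fixes-B₁ _ βαβ⁻¹≈αᵗ _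
  a b r a∈G a-order a-semiregular a↦α b∈G b↦β _ b-order =
  N∩⟨b⟩≐⟨bᵈ⟩ b-order ,
  λ { refl → K⋊⟨a⟩ a∈G a-order a-semiregular K-not-derangements ,
             N⋊⟨b⟩ {t} (subst (IsOrder b) (*-identityˡ d) b-order) (≈⇒≋ {τ = α ^ t} βαβ⁻¹≈αᵗ) }
  where
  blk-surjective : StrictlySurjective _≡_ blk
  blk-surjective i with blocks-of-size-3 i
  ... | x , _ , _ , _ , _ , _ , blkx≡i , _ = x , blkx≡i
  open BlockKernel G-isSubgroup blk G-preserves-blocks
  open Lifts blk-surjective α-fullCycle β-order β-fixes-B₁ a∈G a↦α b∈G b↦β
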